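{- Let $p,q \geq 4$ be integers with $p \geq q$. Then $\zeta(C_{2p} \square C_{2q}) = 2$.
   Context: The localization game on a connected graph $G$ is played by a Cop controlling $k$ cops and a Robber. The Robber first chooses a vertex $r$, unknown to the Cop. In each turn the Cop probes a set $B=\{b_1,\dots,b_k\}$ of $k$ vertices and receives the distance vector $[d_G(r,b_1),\dots,d_G(r,b_k)]$. If the Cop can determine $r$ exactly, the Cop wins; otherwise the Robber may stay at $r$ or move to a neighbour of $r$, and the next turn begins. The Cop wins if the Robber is located after finitely many turns. The localization number $\zeta(G)$ is the least positive integer $k$ such that the Cop has a winning strategy with $k$ cops. $C_n$ is the cycle of order $n$ and $\square$ the Cartesian product. -}

module Defs where

open import Level using (0ℓ)
open import Data.Nat using (ℕ; zero; suc; _+_; _≤_; _%_; NonZero)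
open import Data.Fin using (Fin; toℕ)
open import Data.Product using (Σ; _×_; _,_)
open import Data.Sum using (_⊎_)
open import Data.Unit using (⊤)
open import Data.Empty using (⊥)
open import Relation.Nullary using (¬_)
open import Relation.Binary.PropositionalEquality using (_≡_)

record Graph : Set₁ where
  field
    V   : Set
    Adj : V → V → Set
open Graph public

SuccMod : ℕ → ℕ → ℕ → Set
SuccMod n i j = (j ≡ suc i) ⊎ (suc i ≡ n × j ≡ 0)

Cycle : ℕ → Graph
Cycle n = record
  { V   = Fin n
  ; Adj = λ i j → SuccMod n (toℕ i) (toℕ j) ⊎ SuccMod n (toℕ j) (toℕ i)
  }

_□_ : Graph → Graph → Graph
G □ H = record
  { V   = V G × V H
  ; Adj = λ { (g , h) (g' , h') → (Adj G g g' × h ≡ h') ⊎ (g ≡ g' × Adj H h h') }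
  }

data Walk (G : Graph) : V G → V G → ℕ → Set where
  here : ∀ {u} → Walk G u u zero
  next : ∀ {u v w n} → Adj G u v → Walk G v w n → Walk G u w (suc n)

IsDist : (G : Graph) → V G → V G → ℕ → Set
IsDist G u v d = Walk G u v d × (∀ m → Walk G u v m → d ≤ m)

-- Sets of possible robber positions, as predicates.
VSet : Graph → Set₁
VSet G = V G → Set

-- The Cop has located the robber: at most one position is consistent.
Located : (G : Graph) → VSet G → Set
Located G S = ∀ v w → S v → S w → v ≡ w

-- Positions in S consistent with the answer f to probe B.
Consistent : (G : Graph) {k : ℕ} → VSet G → (Fin k → V G) → (Fin k → ℕ) → VSet G
Consistent G S B f v = S v × (∀ i → IsDist G v (B i) (f i))

-- Closed neighbourhood N[T]: where the robber can be after staying or moving.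
ClosedNbhd : (G : Graph) → VSet G → VSet G
ClosedNbhd G T w = Σ (V G) λ v → T v × (v ≡ w ⊎ Adj G v w)

-- CopWins G k S : the Cop with k cops has a strategy that locates the
-- robber in finitely many turns, when the set of robber positions consistent
-- with all information so far is S.  In a turn, the Cop probes B; for every
-- possible answer f, either the robber is located, or the robber moves
-- (or stays) and the Cop wins from the new consistent set.
data CopWins (G : Graph) (k : ℕ) : VSet G → Set₁ where
  probe : ∀ {S} (B : Fin k → V G) →
          (∀ (f : Fin k → ℕ) →
             Located G (Consistent G S B f)
             ⊎ CopWins G k (ClosedNbhd G (Consistent G S B f))) →
          CopWins G k S

CopWinsWith : Graph → ℕ → Set₁
CopWinsWith G k = CopWins G k (λ _ → ⊤)

LocalizationNumberIs : Graph → ℕ → Set₁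
LocalizationNumberIs G k =
  (1 ≤ k) × CopWinsWith G k × (∀ j → 1 ≤ j → suc j ≤ k → ¬ CopWinsWith G j)

-- Two cops probing (a , b) and its antipode (a + p , b) learn the robber's distances in the two
-- cycle factors separately.  The distance s to a fixed vertex z of a cycle leaves two candidates,
-- z + s and z - s; after the robber moves, a probe at z + s tells which of them he came from, so he
-- is within 1 of a known vertex, and after his next move within 2 of it.  The five vertices of
-- that ball have distinct distances to its first vertex when p, q ≥ 4, so the third probe locates
-- him.  One cop never suffices: the four distinct neighbours of the robber's vertex have only three
-- possible distances to the probe, so he can always hide at one of two of them.

module Submission where

open import Data.Nat using (ℕ; zero; suc; _+_; _*_; _∸_; _⊓_; _≤_; _<_; z≤n; s≤s; z<s; >-nonZero; >-nonZero⁻¹; _≤?_; _<?_; ⌊_/2⌋; NonZero)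
open import Data.Nat.Properties
open import Data.Nat.DivMod using (_%_; _mod_; m%n<n; m%n≤m; m<n⇒m%n≡m; n%n≡0; [m+n]%n≡m%n; m%n%n≡m%n; %-distribˡ-+)
open import Data.Fin as Fin using (Fin; zero; suc; toℕ; fromℕ<)
open import Data.Fin.Properties using (toℕ-injective; toℕ<n; toℕ-fromℕ<; pigeonhole)
open import Data.Product using (Σ; ∃₂; _×_; _,_; proj₁; proj₂)
open import Data.Sum using (_⊎_; inj₁; inj₂; swap)
open import Data.Empty using (⊥; ⊥-elim)
open import Relation.Nullary using (¬_; yes; no)
open import Relation.Unary using (Pred; _⟨×⟩_)
open import Level using (0ℓ)
open import Data.Unit using (⊤; tt)
open import Function using (_∘_)
open import Relation.Binary.PropositionalEquality
open ≡-Reasoning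
open import Data.Nat.Solver using (module +-*-Solver)
open +-*-Solver using (solve; _:+_; _:=_)

open import Defs

[m%d+n]%d≡[m+n]%d : ∀ m n d .{{_ : NonZero d}} → (m % d + n) % d ≡ (m + n) % d
[m%d+n]%d≡[m+n]%d m n d = begin
  (m % d + n) % d         ≡⟨ %-distribˡ-+ (m % d) n d ⟩
  (m % d % d + n % d) % d ≡⟨ cong (λ t → (t + n % d) % d) (m%n%n≡m%n m d) ⟩
  (m % d + n % d) % d     ≡⟨ %-distribˡ-+ m n d ⟨
  (m + n) % d             ∎

m∸n≤1+m∸[1+n] : ∀ m n → m ∸ n ≤ suc (m ∸ suc n)
m∸n≤1+m∸[1+n] zero    zero    = z≤n
m∸n≤1+m∸[1+n] zero    (suc n) = z≤n
m∸n≤1+m∸[1+n] (suc m) zero    = ≤-refl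
m∸n≤1+m∸[1+n] (suc m) (suc n) = m∸n≤1+m∸[1+n] m n

Move : (G : Graph) → V G → V G → Set
Move G u v = u ≡ v ⊎ Adj G u v

infixr 5 _++ᵂ_
_++ᵂ_ : ∀ {G u v w i j} → Walk G u v i → Walk G v w j → Walk G u w (i + j)
here        ++ᵂ w′ = w′
next uv w   ++ᵂ w′ = next uv (w ++ᵂ w′)

walk-□ˡ : ∀ {G H x x′ k} y → Walk G x x′ k → Walk (G □ H) (x , y) (x′ , y) k
walk-□ˡ y here        = here
walk-□ˡ y (next xx w) = next (inj₁ (xx , refl)) (walk-□ˡ y w)

walk-□ʳ : ∀ {G H y y′ k} x → Walk H y y′ k → Walk (G □ H) (x , y) (x , y′) k
walk-□ʳ x here        = here
walk-□ʳ x (next yy w) = next (inj₂ (refl , yy)) (walk-□ʳ x w)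

□-move : ∀ {G H x₀ y₀ x y} → Move (G □ H) (x₀ , y₀) (x , y) → Move G x₀ x × Move H y₀ y
□-move (inj₁ refl)               = inj₁ refl , inj₁ refl
□-move (inj₂ (inj₁ (xx , refl))) = inj₂ xx , inj₁ refl
□-move (inj₂ (inj₂ (refl , yy))) = inj₁ refl , inj₂ yy

walk-length-≥ : ∀ {G c} (f : V G → ℕ) → f c ≡ 0 → (∀ {u v} → Adj G u v → f u ≤ suc (f v)) →
                ∀ {u k} → Walk G u c k → f u ≤ k
walk-length-≥ f f-c≡0 lipschitz here        = ≤-reflexive f-c≡0
walk-length-≥ f f-c≡0 lipschitz (next uv w) = ≤-trans (lipschitz uv) (s≤s (walk-length-≥ f f-c≡0 lipschitz w))

IsDist-unique : ∀ {G u v d d′} → IsDist G u v d → IsDist G u v d′ → d ≡ d′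
IsDist-unique (w , shortest) (w′ , shortest′) = ≤-antisym (shortest _ w′) (shortest′ _ w)

CopWins-mono : ∀ {G k} {S S′ : VSet G} → CopWins G k S → (∀ v → S′ v → S v) → CopWins G k S′
CopWins-mono {G} {k} {S} {S′} (probe B next-turn) S′⊆S = probe B λ f → shrink f (next-turn f)
  where
  consistent-⊆ : ∀ f v → Consistent G S′ B f v → Consistent G S B f v
  consistent-⊆ f v (v∈S′ , answers) = S′⊆S v v∈S′ , answers
  shrink : ∀ f → Located G (Consistent G S B f) ⊎ CopWins G k (ClosedNbhd G (Consistent G S B f)) →
           Located G (Consistent G S′ B f) ⊎ CopWins G k (ClosedNbhd G (Consistent G S′ B f))
  shrink f (inj₁ located) = inj₁ λ v w v∈ w∈ → located v w (consistent-⊆ f v v∈) (consistent-⊆ f w w∈)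
  shrink f (inj₂ wins)    = inj₂ (CopWins-mono wins λ { w (v , v∈ , vw) → v , consistent-⊆ f v v∈ , vw })

TwinNeighbours : (G : Graph) → (V G → V G → ℕ) → V G → V G → Set
TwinNeighbours G dist v b = Σ (V G) λ u → Σ (V G) λ w → Adj G v u × Adj G v w × u ≢ w × dist u b ≡ dist w b

module _ (G : Graph) (dist : V G → V G → ℕ) (dist-isDist : ∀ u b → IsDist G u b (dist u b))
         (twins : ∀ v b → TwinNeighbours G dist v b) where

  one-cop-loses : ∀ {S} → CopWins G 1 S → ∀ v → (∀ w → Move G v w → S w) → ⊥
  one-cop-loses {S} (probe B next-turn) v N[v]⊆S with twins v (B zero)
  ... | u , w , vu , vw , u≢w , same = escape (next-turn answer)
    where
    answer : Fin 1 → ℕ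
    answer _ = dist u (B zero)
    seen : ∀ {x} → Adj G v x → dist x (B zero) ≡ dist u (B zero) → Consistent G S B answer x
    seen {x} vx eq = N[v]⊆S x (inj₂ vx) , λ { zero → subst (IsDist G x (B zero)) eq (dist-isDist x (B zero)) }
    escape : Located G (Consistent G S B answer) ⊎ CopWins G 1 (ClosedNbhd G (Consistent G S B answer)) → ⊥
    escape (inj₁ located) = u≢w (located u w (seen vu refl) (seen vw (sym same)))
    escape (inj₂ wins)    = one-cop-loses wins u λ x ux → u , seen vu refl , ux

window-pigeonhole : ∀ {k} → 3 < k → (f : Fin k → ℕ) {M : ℕ} →
                    (∀ i → f i ≤ suc M) → (∀ i → M ≤ suc (f i)) → ∃₂ λ i j → i Fin.< j × f i ≡ f j
window-pigeonhole 3<k f {M} upper lower = equal-values (pigeonhole 3<k slot)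
  where
  slot : _ → Fin 3
  slot i = fromℕ< (s≤s (m≤n+o⇒m∸n≤o (suc (f i)) M (subst (suc (f i) ≤_) (+-comm 2 M) (s≤s (upper i)))))
  equal-values : ∃₂ (λ i j → i Fin.< j × slot i ≡ slot j) → ∃₂ λ i j → i Fin.< j × f i ≡ f j
  equal-values (i , j , i<j , same-slot) = i , j , i<j , suc-injective (∸-cancelʳ-≡ (lower i) (lower j) same-offset)
    where
    same-offset : suc (f i) ∸ M ≡ suc (f j) ∸ M
    same-offset = trans (sym (toℕ-fromℕ< _)) (trans (cong toℕ same-slot) (toℕ-fromℕ< _))

module OnCycle (n : ℕ) .{{_ : NonZero n}} where

  C : Graph
  C = Cycle n

  origin : Fin n
  origin = fromℕ< (>-nonZero⁻¹ n)

  infixl 6 _⊕_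
  _⊕_ : Fin n → ℕ → Fin n
  a ⊕ k = (toℕ a + k) mod n

  toℕ-⊕ : ∀ a k → toℕ (a ⊕ k) ≡ (toℕ a + k) % n
  toℕ-⊕ a k = toℕ-fromℕ< (m%n<n (toℕ a + k) n)

  toℕ-%n : ∀ (x : Fin n) → toℕ x % n ≡ toℕ x
  toℕ-%n x = m<n⇒m%n≡m (toℕ<n x)

  ⊕-assoc : ∀ a i j → a ⊕ i ⊕ j ≡ a ⊕ (i + j)
  ⊕-assoc a i j = toℕ-injective (begin
    toℕ (a ⊕ i ⊕ j)             ≡⟨ toℕ-⊕ (a ⊕ i) j ⟩
    (toℕ (a ⊕ i) + j) % n       ≡⟨ cong (λ t → (t + j) % n) (toℕ-⊕ a i) ⟩
    ((toℕ a + i) % n + j) % n   ≡⟨ [m%d+n]%d≡[m+n]%d (toℕ a + i) j n ⟩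
    (toℕ a + i + j) % n         ≡⟨ cong (_% n) (+-assoc (toℕ a) i j) ⟩
    (toℕ a + (i + j)) % n       ≡⟨ toℕ-⊕ a (i + j) ⟨
    toℕ (a ⊕ (i + j))           ∎)

  ⊕-identityʳ : ∀ a → a ⊕ 0 ≡ a
  ⊕-identityʳ a = toℕ-injective (trans (toℕ-⊕ a 0) (trans (cong (_% n) (+-identityʳ (toℕ a))) (toℕ-%n a)))

  ⊕-+n : ∀ a k → a ⊕ (k + n) ≡ a ⊕ k
  ⊕-+n a k = toℕ-injective (begin
    toℕ (a ⊕ (k + n))     ≡⟨ toℕ-⊕ a (k + n) ⟩
    (toℕ a + (k + n)) % n ≡⟨ cong (_% n) (+-assoc (toℕ a) k n) ⟨
    (toℕ a + k + n) % n   ≡⟨ [m+n]%n≡m%n (toℕ a + k) n ⟩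
    (toℕ a + k) % n       ≡⟨ toℕ-⊕ a k ⟨
    toℕ (a ⊕ k)           ∎)

  ⊕-n : ∀ a → a ⊕ n ≡ a
  ⊕-n a = trans (⊕-+n a 0) (⊕-identityʳ a)

  offset : Fin n → Fin n → ℕ
  offset a x = (toℕ x + (n ∸ toℕ a)) % n

  offset<n : ∀ a x → offset a x < n
  offset<n a x = m%n<n (toℕ x + (n ∸ toℕ a)) n

  ⊕-offset : ∀ a x → a ⊕ offset a x ≡ x
  ⊕-offset a x = toℕ-injective (begin
    toℕ (a ⊕ offset a x)                          ≡⟨ toℕ-⊕ a (offset a x) ⟩
    (toℕ a + (toℕ x + (n ∸ toℕ a)) % n) % n       ≡⟨ cong (_% n) (+-comm (toℕ a) _) ⟩
    ((toℕ x + (n ∸ toℕ a)) % n + toℕ a) % n       ≡⟨ [m%d+n]%d≡[m+n]%d (toℕ x + (n ∸ toℕ a)) (toℕ a) n ⟩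
    (toℕ x + (n ∸ toℕ a) + toℕ a) % n             ≡⟨ cong (_% n) (+-assoc (toℕ x) _ _) ⟩
    (toℕ x + ((n ∸ toℕ a) + toℕ a)) % n           ≡⟨ cong (λ t → (toℕ x + t) % n) (m∸n+n≡m (<⇒≤ (toℕ<n a))) ⟩
    (toℕ x + n) % n                               ≡⟨ [m+n]%n≡m%n (toℕ x) n ⟩
    toℕ x % n                                     ≡⟨ toℕ-%n x ⟩
    toℕ x                                         ∎)

  offset-⊕ : ∀ a x k → offset a (x ⊕ k) ≡ (offset a x + k) % n
  offset-⊕ a x k = begin
    (toℕ (x ⊕ k) + (n ∸ toℕ a)) % n        ≡⟨ cong (λ t → (t + (n ∸ toℕ a)) % n) (toℕ-⊕ x k) ⟩
    ((toℕ x + k) % n + (n ∸ toℕ a)) % n    ≡⟨ [m%d+n]%d≡[m+n]%d (toℕ x + k) (n ∸ toℕ a) n ⟩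
    (toℕ x + k + (n ∸ toℕ a)) % n          ≡⟨ cong (_% n) (+-assoc (toℕ x) k _) ⟩
    (toℕ x + (k + (n ∸ toℕ a))) % n        ≡⟨ cong (λ t → (toℕ x + t) % n) (+-comm k _) ⟩
    (toℕ x + ((n ∸ toℕ a) + k)) % n        ≡⟨ cong (_% n) (+-assoc (toℕ x) _ k) ⟨
    (toℕ x + (n ∸ toℕ a) + k) % n          ≡⟨ [m%d+n]%d≡[m+n]%d (toℕ x + (n ∸ toℕ a)) k n ⟨
    (offset a x + k) % n                   ∎

  offset-self : ∀ a → offset a a ≡ 0
  offset-self a = trans (cong (_% n) (m+[n∸m]≡n (<⇒≤ (toℕ<n a)))) (n%n≡0 n)

  offset-⊕-self : ∀ a k → offset a (a ⊕ k) ≡ k % n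
  offset-⊕-self a k = trans (offset-⊕ a a k) (cong (λ t → (t + k) % n) (offset-self a))

  ⊕-cancelˡ : ∀ a {k l} → k < n → l < n → a ⊕ k ≡ a ⊕ l → k ≡ l
  ⊕-cancelˡ a {k} {l} k<n l<n eq = begin
    k                  ≡⟨ m<n⇒m%n≡m k<n ⟨
    k % n              ≡⟨ offset-⊕-self a k ⟨
    offset a (a ⊕ k)   ≡⟨ cong (offset a) eq ⟩
    offset a (a ⊕ l)   ≡⟨ offset-⊕-self a l ⟩
    l % n              ≡⟨ m<n⇒m%n≡m l<n ⟩
    l                  ∎

  offset-⊕ˡ : ∀ a x {j} → j ≤ n → offset (a ⊕ j) x ≡ (offset a x + (n ∸ j)) % n
  offset-⊕ˡ a x {j} j≤n = begin
    offset (a ⊕ j) x                    ≡⟨ cong (offset (a ⊕ j)) x≡ ⟨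
    offset (a ⊕ j) (a ⊕ j ⊕ (k + (n ∸ j))) ≡⟨ offset-⊕-self (a ⊕ j) _ ⟩
    (k + (n ∸ j)) % n                   ∎
    where
    k = offset a x
    x≡ : a ⊕ j ⊕ (k + (n ∸ j)) ≡ x
    x≡ = begin
      a ⊕ j ⊕ (k + (n ∸ j))   ≡⟨ ⊕-assoc a j _ ⟩
      a ⊕ (j + (k + (n ∸ j))) ≡⟨ cong (λ t → a ⊕ (j + t)) (+-comm k (n ∸ j)) ⟩
      a ⊕ (j + ((n ∸ j) + k)) ≡⟨ cong (a ⊕_) (+-assoc j (n ∸ j) k) ⟨
      a ⊕ (j + (n ∸ j) + k)   ≡⟨ cong (λ t → a ⊕ (t + k)) (m+[n∸m]≡n j≤n) ⟩
      a ⊕ (n + k)             ≡⟨ cong (a ⊕_) (+-comm n k) ⟩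
      a ⊕ (k + n)             ≡⟨ ⊕-+n a k ⟩
      a ⊕ k                   ≡⟨ ⊕-offset a x ⟩
      x                       ∎

  ⊕-suc : ∀ x k → x ⊕ k ⊕ 1 ≡ x ⊕ suc k
  ⊕-suc x k = trans (⊕-assoc x k 1) (cong (x ⊕_) (+-comm k 1))

  SuccMod-functional : ∀ {i j j′} → j < n → j′ < n → SuccMod n i j → SuccMod n i j′ → j ≡ j′
  SuccMod-functional _   _    (inj₁ e)        (inj₁ e′)        = trans e (sym e′)
  SuccMod-functional _   _    (inj₂ (_ , e))  (inj₂ (_ , e′))  = trans e (sym e′)
  SuccMod-functional j<n _    (inj₁ e)        (inj₂ (i+1≡n , _)) = ⊥-elim (<-irrefl (trans e i+1≡n) j<n)
  SuccMod-functional _   j′<n (inj₂ (i+1≡n , _)) (inj₁ e′)     = ⊥-elim (<-irrefl (trans e′ i+1≡n) j′<n)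

  SuccMod-⊕1 : ∀ x → SuccMod n (toℕ x) (toℕ (x ⊕ 1))
  SuccMod-⊕1 x with suc (toℕ x) <? n
  ... | yes x+1<n = inj₁ (trans (toℕ-⊕ x 1) (trans (cong (_% n) (+-comm (toℕ x) 1)) (m<n⇒m%n≡m x+1<n)))
  ... | no x+1≮n = inj₂ (x+1≡n , trans (toℕ-⊕ x 1) (trans (cong (_% n) (trans (+-comm (toℕ x) 1) x+1≡n)) (n%n≡0 n)))
    where
    x+1≡n : suc (toℕ x) ≡ n
    x+1≡n = ≤-antisym (toℕ<n x) (≮⇒≥ x+1≮n)

  adj-⊕1 : ∀ x → Adj C x (x ⊕ 1)
  adj-⊕1 x = inj₁ (SuccMod-⊕1 x)

  adj-⊕1⁻ : ∀ x → Adj C (x ⊕ 1) x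
  adj-⊕1⁻ x = inj₂ (SuccMod-⊕1 x)

  adj⇒⊕1 : ∀ {x y} → Adj C x y → y ≡ x ⊕ 1 ⊎ x ≡ y ⊕ 1
  adj⇒⊕1 {x} {y} (inj₁ s) = inj₁ (toℕ-injective (SuccMod-functional (toℕ<n y) (toℕ<n (x ⊕ 1)) s (SuccMod-⊕1 x)))
  adj⇒⊕1 {x} {y} (inj₂ s) = inj₂ (toℕ-injective (SuccMod-functional (toℕ<n x) (toℕ<n (y ⊕ 1)) s (SuccMod-⊕1 y)))

  walk-up : ∀ x k → Walk C x (x ⊕ k) k
  walk-up x zero    = subst (λ y → Walk C x y 0) (sym (⊕-identityʳ x)) here
  walk-up x (suc k) = next (adj-⊕1 x) (subst (λ y → Walk C (x ⊕ 1) y k) (⊕-assoc x 1 k) (walk-up (x ⊕ 1) k))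

  walk-down : ∀ x k → Walk C (x ⊕ k) x k
  walk-down x zero    = subst (λ y → Walk C y x 0) (sym (⊕-identityʳ x)) here
  walk-down x (suc k) = subst (λ y → Walk C y x (suc k)) (⊕-suc x k) (next (adj-⊕1⁻ (x ⊕ k)) (walk-down x k))

  shorterArc : ℕ → ℕ
  shorterArc k = k ⊓ (n ∸ k)

  dist : Fin n → Fin n → ℕ
  dist x a = shorterArc (offset a x)

  dist-self : ∀ a → dist a a ≡ 0
  dist-self a = cong shorterArc (offset-self a)

  arc-walk : ∀ a {k} → k < n → Walk C (a ⊕ k) a (shorterArc k)
  arc-walk a {k} k<n with k ≤? n ∸ k
  ... | yes k≤n-k = subst (Walk C (a ⊕ k) a) (sym (m≤n⇒m⊓n≡m k≤n-k)) (walk-down a k)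
  ... | no k≰n-k  = subst₂ (Walk C (a ⊕ k)) around (sym (m≥n⇒m⊓n≡n (≰⇒≥ k≰n-k))) (walk-up (a ⊕ k) (n ∸ k))
    where
    around : a ⊕ k ⊕ (n ∸ k) ≡ a
    around = trans (⊕-assoc a k (n ∸ k)) (trans (cong (a ⊕_) (m+[n∸m]≡n (<⇒≤ k<n))) (⊕-n a))

  dist-walk : ∀ x a → Walk C x a (dist x a)
  dist-walk x a = subst (λ y → Walk C y a (dist x a)) (⊕-offset a x) (arc-walk a (offset<n a x))

  shorterArc-% : ∀ {k} → k ≤ n → shorterArc (k % n) ≡ shorterArc k
  shorterArc-% k≤n with m≤n⇒m<n∨m≡n k≤n
  ... | inj₁ k<n  = cong shorterArc (m<n⇒m%n≡m k<n)
  ... | inj₂ refl = trans (cong shorterArc (n%n≡0 n)) (sym (trans (cong (n ⊓_) (n∸n≡0 n)) (⊓-zeroʳ n)))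

  shorterArc-suc-≤ : ∀ k → shorterArc (suc k) ≤ suc (shorterArc k)
  shorterArc-suc-≤ k = ⊓-monoʳ-≤ (suc k) (≤-trans (∸-monoʳ-≤ n (n≤1+n k)) (n≤1+n (n ∸ k)))

  shorterArc-≤-suc : ∀ k → shorterArc k ≤ suc (shorterArc (suc k))
  shorterArc-≤-suc k = ⊓-mono-≤ (≤-trans (n≤1+n k) (n≤1+n (suc k))) (m∸n≤1+m∸[1+n] n k)

  dist-⊕1 : ∀ x a → dist (x ⊕ 1) a ≡ shorterArc (suc (offset a x))
  dist-⊕1 x a = begin
    shorterArc (offset a (x ⊕ 1))        ≡⟨ cong shorterArc (offset-⊕ a x 1) ⟩
    shorterArc ((offset a x + 1) % n)    ≡⟨ shorterArc-% (subst (_≤ n) (+-comm 1 _) (offset<n a x)) ⟩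
    shorterArc (offset a x + 1)          ≡⟨ cong shorterArc (+-comm _ 1) ⟩
    shorterArc (suc (offset a x))        ∎

  dist-lipschitz : ∀ {u v} a → Adj C u v → dist u a ≤ suc (dist v a)
  dist-lipschitz {u} {v} a uv with adj⇒⊕1 uv
  ... | inj₁ refl = subst (λ d → dist u a ≤ suc d) (sym (dist-⊕1 u a)) (shorterArc-≤-suc (offset a u))
  ... | inj₂ refl = subst (_≤ suc (dist v a)) (sym (dist-⊕1 v a)) (shorterArc-suc-≤ (offset a v))

  dist-move : ∀ {x₀ x} a → Move C x₀ x → dist x a ≤ suc (dist x₀ a)
  dist-move a (inj₁ refl) = n≤1+n _
  dist-move a (inj₂ adj)  = dist-lipschitz a (swap adj)

  dist-sphere : ∀ {x a s} → dist x a ≡ s → x ≡ a ⊕ s ⊎ x ≡ a ⊕ (n ∸ s)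
  dist-sphere {x} {a} refl with ⊓-sel (offset a x) (n ∸ offset a x)
  ... | inj₁ min≡k = inj₁ (trans (sym (⊕-offset a x)) (cong (a ⊕_) (sym min≡k)))
  ... | inj₂ min≡n-k = inj₂ (trans (sym (⊕-offset a x)) (cong (a ⊕_) k≡))
    where
    k≡ : offset a x ≡ n ∸ shorterArc (offset a x)
    k≡ = trans (sym (m∸[m∸n]≡n (<⇒≤ (offset<n a x)))) (cong (n ∸_) (sym min≡n-k))

  dist-move-≤1 : ∀ {x₀ x} → Move C x₀ x → dist x x₀ ≤ 1
  dist-move-≤1 {x₀} {x} mv = subst (λ d → dist x x₀ ≤ suc d) (dist-self x₀) (dist-move x₀ mv)

  [k+r]%n≤r+r : ∀ {k r} → k ≤ n → shorterArc k ≤ r → (k + r) % n ≤ r + r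
  [k+r]%n≤r+r {k} {r} k≤n short with ⊓-sel k (n ∸ k)
  ... | inj₁ min≡k = ≤-trans (m%n≤m (k + r) n) (+-monoˡ-≤ r (subst (_≤ r) min≡k short))
  ... | inj₂ min≡n-k = subst (_≤ r + r) (sym wrap)
          (≤-trans (m%n≤m (k + r ∸ n) n) (≤-trans (m≤n+o⇒m∸n≤o (k + r) n (+-monoˡ-≤ r k≤n)) (m≤m+n r r)))
    where
    n≤k+r : n ≤ k + r
    n≤k+r = subst (_≤ k + r) (m+[n∸m]≡n k≤n) (+-monoʳ-≤ k (subst (_≤ r) min≡n-k short))
    wrap : (k + r) % n ≡ (k + r ∸ n) % n
    wrap = trans (cong (_% n) (sym (m∸n+n≡m n≤k+r))) ([m+n]%n≡m%n (k + r ∸ n) n)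

  ball-in-arc : ∀ {x e r} → r ≤ n → dist x e ≤ r → offset (e ⊕ (n ∸ r)) x ≤ r + r
  ball-in-arc {x} {e} {r} r≤n close = subst (_≤ r + r) (sym shifted) ([k+r]%n≤r+r (<⇒≤ (offset<n e x)) close)
    where
    shifted : offset (e ⊕ (n ∸ r)) x ≡ (offset e x + r) % n
    shifted = trans (offset-⊕ˡ e x (m∸n≤m n r)) (cong (λ t → (offset e x + t) % n) (m∸[m∸n]≡n r≤n))

  NearSphere : Fin n → ℕ → Fin n → Set
  NearSphere z s x = Σ (Fin n) λ x₁ → dist x₁ z ≡ s × Move C x₁ x

  near-sphere : ∀ z {x₀ x} → Move C x₀ x → NearSphere z (dist x₀ z) x
  near-sphere z {x₀} mv = x₀ , refl , mv

  -- The robber came from z ⊕ s or from z ⊕ (n ∸ s); if he is not within 1 of z ⊕ s, it was the latter.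
  center : Fin n → ℕ → ℕ → Fin n
  center z s σ with σ ≤? 1
  ... | yes _ = z ⊕ s
  ... | no _  = z ⊕ (n ∸ s)

  near-center : ∀ {z s x₀} → NearSphere z s x₀ → dist x₀ (center z s (dist x₀ (z ⊕ s))) ≤ 1
  near-center {z} {s} {x₀} (x₁ , x₁-on-sphere , mv) with dist x₀ (z ⊕ s) ≤? 1 | dist-sphere {x₁} {z} x₁-on-sphere
  ... | yes close | _         = close
  ... | no far    | inj₁ refl = ⊥-elim (far (dist-move-≤1 mv))
  ... | no _      | inj₂ refl = dist-move-≤1 mv

  near-center-move : ∀ {z s x₀ x} → NearSphere z s x₀ → Move C x₀ x → dist x (center z s (dist x₀ (z ⊕ s))) ≤ 2
  near-center-move {z} {s} {x₀} x₀-near mv =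
    ≤-trans (dist-move (center z s (dist x₀ (z ⊕ s))) mv) (s≤s (near-center x₀-near))

  ⊕-pred-⊕1 : ∀ x → x ⊕ (n ∸ 1) ⊕ 1 ≡ x
  ⊕-pred-⊕1 x = trans (⊕-assoc x (n ∸ 1) 1) (trans (cong (x ⊕_) (m∸n+n≡m (>-nonZero⁻¹ n))) (⊕-n x))

  adj-⊕pred : ∀ x → Adj C x (x ⊕ (n ∸ 1))
  adj-⊕pred x = subst (λ y → Adj C y (x ⊕ (n ∸ 1))) (⊕-pred-⊕1 x) (adj-⊕1⁻ (x ⊕ (n ∸ 1)))

  ⊕-≢-self : ∀ x {k} → 0 < k → k < n → x ⊕ k ≢ x
  ⊕-≢-self x 0<k k<n eq =
    <-irrefl (sym (⊕-cancelˡ x k<n (>-nonZero⁻¹ n) (trans eq (sym (⊕-identityʳ x))))) 0<k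

  ⊕1≢self : 3 ≤ n → ∀ x → x ⊕ 1 ≢ x
  ⊕1≢self 3≤n x = ⊕-≢-self x z<s (≤-trans (s≤s (s≤s z≤n)) 3≤n)

  ⊕pred≢self : 3 ≤ n → ∀ x → x ⊕ (n ∸ 1) ≢ x
  ⊕pred≢self 3≤n x = ⊕-≢-self x (m+n≤o⇒m≤o∸n 1 (≤-trans (s≤s (s≤s z≤n)) 3≤n)) (∸-monoʳ-< z<s (>-nonZero⁻¹ n))

  ⊕1≢⊕pred : 3 ≤ n → ∀ x → x ⊕ 1 ≢ x ⊕ (n ∸ 1)
  ⊕1≢⊕pred 3≤n x eq = <-irrefl (⊕-cancelˡ x 1<n (∸-monoʳ-< z<s (>-nonZero⁻¹ n)) eq) (m+n≤o⇒m≤o∸n 2 3≤n)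
    where
    1<n : 1 < n
    1<n = ≤-trans (s≤s (s≤s z≤n)) 3≤n

module OnEvenCycle (p : ℕ) .{{_ : NonZero p}} where
  instance
    2p-nonZero : NonZero (2 * p)
    2p-nonZero = m*n≢0 2 p

  open OnCycle (2 * p) public

  2p≡p+p : 2 * p ≡ p + p
  2p≡p+p = cong (p +_) (+-identityʳ p)

  shorterArc-≤half : ∀ {k} → k ≤ p → shorterArc k ≡ k
  shorterArc-≤half {k} k≤p =
    m≤n⇒m⊓n≡m (m+n≤o⇒m≤o∸n k (subst (k + k ≤_) (sym 2p≡p+p) (+-mono-≤ k≤p k≤p)))

  shorterArc-≥half : ∀ {j} → j ≤ p → shorterArc (p + j) ≡ p ∸ j
  shorterArc-≥half {j} j≤p =
    trans (cong ((p + j) ⊓_) 2p-[p+j]) (m≥n⇒m⊓n≡n (≤-trans (m∸n≤m p j) (m≤m+n p j)))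
    where
    2p-[p+j] : 2 * p ∸ (p + j) ≡ p ∸ j
    2p-[p+j] = trans (cong (_∸ (p + j)) 2p≡p+p) ([m+n]∸[m+o]≡n∸o p p j)

  shorterArc-antipodal : ∀ {k} → k < 2 * p → shorterArc k + shorterArc ((k + p) % (2 * p)) ≡ p
  shorterArc-antipodal {k} k<2p with p ≤? k
  ... | no p≰k = begin
    shorterArc k + shorterArc ((k + p) % (2 * p)) ≡⟨ cong₂ _+_ (shorterArc-≤half k≤p) (cong shorterArc (m<n⇒m%n≡m k+p<2p)) ⟩
    k + shorterArc (k + p)                        ≡⟨ cong (λ t → k + shorterArc t) (+-comm k p) ⟩
    k + shorterArc (p + k)                        ≡⟨ cong (k +_) (shorterArc-≥half k≤p) ⟩
    k + (p ∸ k)                                   ≡⟨ m+[n∸m]≡n k≤p ⟩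
    p                                             ∎
    where
    k≤p : k ≤ p
    k≤p = <⇒≤ (≰⇒> p≰k)
    k+p<2p : k + p < 2 * p
    k+p<2p = subst (k + p <_) (sym 2p≡p+p) (+-monoˡ-< p (≰⇒> p≰k))
  ... | yes p≤k = begin
    shorterArc k + shorterArc ((k + p) % (2 * p)) ≡⟨ cong₂ _+_ (cong shorterArc (sym p+j≡k)) (cong shorterArc wrap) ⟩
    shorterArc (p + j) + shorterArc j             ≡⟨ cong₂ _+_ (shorterArc-≥half (<⇒≤ j<p)) (shorterArc-≤half (<⇒≤ j<p)) ⟩
    (p ∸ j) + j                                   ≡⟨ m∸n+n≡m (<⇒≤ j<p) ⟩
    p                                             ∎
    where
    j = k ∸ p
    p+j≡k : p + j ≡ k
    p+j≡k = m+[n∸m]≡n p≤k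
    j<p : j < p
    j<p = +-cancelˡ-< p j p (subst (_< p + p) (sym p+j≡k) (subst (k <_) 2p≡p+p k<2p))
    wrap : (k + p) % (2 * p) ≡ j
    wrap = begin
      (k + p) % (2 * p)         ≡⟨ cong (λ t → (t + p) % (2 * p)) (sym p+j≡k) ⟩
      (p + j + p) % (2 * p)     ≡⟨ cong (_% (2 * p)) (trans (cong (_+ p) (+-comm p j)) (trans (+-assoc j p p) (cong (j +_) (sym 2p≡p+p)))) ⟩
      (j + 2 * p) % (2 * p)     ≡⟨ [m+n]%n≡m%n j (2 * p) ⟩
      j % (2 * p)               ≡⟨ m<n⇒m%n≡m (≤-trans j<p (m≤m+n p (p + 0))) ⟩
      j                         ∎

  dist-antipodal : ∀ x a → dist x a + dist x (a ⊕ p) ≡ p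
  dist-antipodal x a = trans (cong (dist x a +_) (cong shorterArc antipode-offset)) (shorterArc-antipodal (offset<n a x))
    where
    antipode-offset : offset (a ⊕ p) x ≡ (offset a x + p) % (2 * p)
    antipode-offset = trans (offset-⊕ˡ a x (m≤m+n p (p + 0)))
                            (cong (λ t → (offset a x + t) % (2 * p)) (trans (cong (_∸ p) 2p≡p+p) (m+n∸n≡m p p)))

  arc-injective : ∀ {a x y} → offset a x ≤ p → offset a y ≤ p → dist x a ≡ dist y a → x ≡ y
  arc-injective {a} {x} {y} x-near y-near same = begin
    x                 ≡⟨ ⊕-offset a x ⟨
    a ⊕ offset a x    ≡⟨ cong (a ⊕_) (trans (sym (shorterArc-≤half x-near)) (trans same (shorterArc-≤half y-near))) ⟩
    a ⊕ offset a y    ≡⟨ ⊕-offset a y ⟩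
    y                 ∎

  ball₂-separated : 4 ≤ p → ∀ {c x y} → dist x c ≤ 2 → dist y c ≤ 2 →
                    dist x (c ⊕ (2 * p ∸ 2)) ≡ dist y (c ⊕ (2 * p ∸ 2)) → x ≡ y
  ball₂-separated 4≤p {c} {x} {y} x-near y-near =
    arc-injective {c ⊕ (2 * p ∸ 2)} (≤-trans (ball-in-arc {x} {c} 2≤2p x-near) 4≤p) (≤-trans (ball-in-arc {y} {c} 2≤2p y-near) 4≤p)
    where
    2≤2p : 2 ≤ 2 * p
    2≤2p = ≤-trans (s≤s (s≤s z≤n)) (≤-trans 4≤p (m≤m+n p (p + 0)))

decodeʸ : ℕ → ℕ → ℕ → ℕ
decodeʸ p f₀ f₁ = ⌊ f₀ + f₁ ∸ p /2⌋

decodeˣ : ℕ → ℕ → ℕ → ℕ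
decodeˣ p f₀ f₁ = f₀ ∸ decodeʸ p f₀ f₁

decodeʸ-correct : ∀ {p} x x′ y → x + x′ ≡ p → decodeʸ p (x + y) (x′ + y) ≡ y
decodeʸ-correct {p} x x′ y x+x′≡p = begin
  ⌊ (x + y) + (x′ + y) ∸ p /2⌋        ≡⟨ cong (λ t → ⌊ t ∸ p /2⌋) (regroup x x′ y) ⟩
  ⌊ (y + y) + (x + x′) ∸ p /2⌋        ≡⟨ cong (λ t → ⌊ (y + y) + t ∸ p /2⌋) x+x′≡p ⟩
  ⌊ (y + y) + p ∸ p /2⌋               ≡⟨ cong ⌊_/2⌋ (m+n∸n≡m (y + y) p) ⟩
  ⌊ y + y /2⌋                         ≡⟨ n≡⌊n+n/2⌋ y ⟨
  y                                   ∎
  where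
  regroup : ∀ a b c → (a + c) + (b + c) ≡ (c + c) + (a + b)
  regroup = solve 3 (λ a b c → (a :+ c) :+ (b :+ c) := (c :+ c) :+ (a :+ b)) refl

decodeˣ-correct : ∀ {p} x x′ y → x + x′ ≡ p → decodeˣ p (x + y) (x′ + y) ≡ x
decodeˣ-correct x x′ y x+x′≡p = trans (cong (x + y ∸_) (decodeʸ-correct x x′ y x+x′≡p)) (m+n∸n≡m x y)

module Torus (p q : ℕ) (4≤p : 4 ≤ p) (4≤q : 4 ≤ q) where
  instance
    p-nonZero : NonZero p
    p-nonZero = >-nonZero (≤-trans (s≤s z≤n) 4≤p)
    q-nonZero : NonZero q
    q-nonZero = >-nonZero (≤-trans (s≤s z≤n) 4≤q)

  module X = OnEvenCycle p
  module Y = OnEvenCycle q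

  3≤2p : 3 ≤ 2 * p
  3≤2p = ≤-trans (s≤s (s≤s (s≤s z≤n))) (≤-trans 4≤p (m≤m+n p (p + 0)))

  3≤2q : 3 ≤ 2 * q
  3≤2q = ≤-trans (s≤s (s≤s (s≤s z≤n))) (≤-trans 4≤q (m≤m+n q (q + 0)))

  G : Graph
  G = Cycle (2 * p) □ Cycle (2 * q)

  dist : V G → V G → ℕ
  dist (x , y) (a , b) = X.dist x a + Y.dist y b

  adj-sym : ∀ {u v} → Adj G u v → Adj G v u
  adj-sym (inj₁ (xx , refl)) = inj₁ (swap xx , refl)
  adj-sym (inj₂ (refl , yy)) = inj₂ (refl , swap yy)

  dist-lipschitz : ∀ c {u v} → Adj G u v → dist u c ≤ suc (dist v c)
  dist-lipschitz (a , b) {x , y} {_ , y′} (inj₁ (xx , refl)) = +-monoˡ-≤ (Y.dist y′ b) (X.dist-lipschitz a xx)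
  dist-lipschitz (a , b) {x , y} {x′ , y′} (inj₂ (refl , yy)) =
    ≤-trans (+-monoʳ-≤ (X.dist x a) (Y.dist-lipschitz b yy)) (≤-reflexive (+-suc (X.dist x a) (Y.dist y′ b)))

  dist-isDist : ∀ u c → IsDist G u c (dist u c)
  dist-isDist (x , y) (a , b) =
    walk-□ˡ y (X.dist-walk x a) ++ᵂ walk-□ʳ a (Y.dist-walk y b) ,
    λ _ → walk-length-≥ (λ u → dist u (a , b)) (cong₂ _+_ (X.dist-self a) (Y.dist-self b)) (dist-lipschitz (a , b))

  -- A vertex and its antipode in the first factor: the answers X + Y and (p - X) + Y determine
  -- the distances X and Y in the two factors.
  probes : Fin (2 * p) → Fin (2 * q) → Fin 2 → V G
  probes a b zero       = a , b
  probes a b (suc zero) = a X.⊕ p , b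

  probes-reveal : ∀ a b {f : Fin 2 → ℕ} {x y} → (∀ i → IsDist G (x , y) (probes a b i) (f i)) →
                  X.dist x a ≡ decodeˣ p (f zero) (f (suc zero)) × Y.dist y b ≡ decodeʸ p (f zero) (f (suc zero))
  probes-reveal a b {f} {x} {y} answers =
    sym (trans (cong₂ (decodeˣ p) f₀ f₁) (decodeˣ-correct (X.dist x a) (X.dist x (a X.⊕ p)) (Y.dist y b) (X.dist-antipodal x a))) ,
    sym (trans (cong₂ (decodeʸ p) f₀ f₁) (decodeʸ-correct (X.dist x a) (X.dist x (a X.⊕ p)) (Y.dist y b) (X.dist-antipodal x a)))
    where
    f₀ : f zero ≡ X.dist x a + Y.dist y b
    f₀ = IsDist-unique (answers zero) (dist-isDist (x , y) (a , b))
    f₁ : f (suc zero) ≡ X.dist x (a X.⊕ p) + Y.dist y b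
    f₁ = IsDist-unique (answers (suc zero)) (dist-isDist (x , y) (a X.⊕ p , b))

  cop-round : ∀ {P Q} (P′ : ℕ → Pred (Fin (2 * p)) 0ℓ) (Q′ : ℕ → Pred (Fin (2 * q)) 0ℓ) a b →
              (∀ {x₀ x} → P x₀ → Move X.C x₀ x → P′ (X.dist x₀ a) x) →
              (∀ {y₀ y} → Q y₀ → Move Y.C y₀ y → Q′ (Y.dist y₀ b) y) →
              (∀ σ τ → CopWins G 2 (P′ σ ⟨×⟩ Q′ τ)) →
              CopWins G 2 (P ⟨×⟩ Q)
  cop-round {P} {Q} P′ Q′ a b stepˣ stepʸ continue = probe (probes a b) λ f →
    inj₂ (CopWins-mono (continue (decodeˣ p (f zero) (f (suc zero))) (decodeʸ p (f zero) (f (suc zero)))) (moved f))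
    where
    moved : ∀ f v → ClosedNbhd G (Consistent G (P ⟨×⟩ Q) (probes a b) f) v →
            (P′ (decodeˣ p (f zero) (f (suc zero))) ⟨×⟩ Q′ (decodeʸ p (f zero) (f (suc zero)))) v
    moved f (x , y) ((x₀ , y₀) , ((x₀∈P , y₀∈Q) , answers) , mv) =
      subst (λ σ → P′ σ x) revealˣ (stepˣ x₀∈P (proj₁ (□-move {X.C} {Y.C} mv))) ,
      subst (λ τ → Q′ τ y) revealʸ (stepʸ y₀∈Q (proj₂ (□-move {X.C} {Y.C} mv)))
      where
      revealˣ = proj₁ (probes-reveal a b answers)
      revealʸ = proj₂ (probes-reveal a b answers)

  cop-locates : ∀ {P Q} a b →
                (∀ {x x′} → P x → P x′ → X.dist x a ≡ X.dist x′ a → x ≡ x′) →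
                (∀ {y y′} → Q y → Q y′ → Y.dist y b ≡ Y.dist y′ b → y ≡ y′) →
                CopWins G 2 (P ⟨×⟩ Q)
  cop-locates a b separatedˣ separatedʸ = probe (probes a b) λ f → inj₁ λ where
    (x , y) (x′ , y′) ((x∈P , y∈Q) , answers) ((x′∈P , y′∈Q) , answers′) →
      cong₂ _,_ (separatedˣ x∈P x′∈P (trans (proj₁ (probes-reveal a b answers)) (sym (proj₁ (probes-reveal a b answers′)))))
                (separatedʸ y∈Q y′∈Q (trans (proj₂ (probes-reveal a b answers)) (sym (proj₂ (probes-reveal a b answers′)))))

  origin : V G
  origin = X.origin , Y.origin

  cop-wins : CopWinsWith G 2
  cop-wins = CopWins-mono opening λ _ _ → tt , tt
    where
    final : ∀ c d → CopWins G 2 ((λ x → X.dist x c ≤ 2) ⟨×⟩ (λ y → Y.dist y d ≤ 2))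
    final c d = cop-locates (c X.⊕ (2 * p ∸ 2)) (d Y.⊕ (2 * q ∸ 2)) (X.ball₂-separated 4≤p) (Y.ball₂-separated 4≤q)
    middle : ∀ s t → CopWins G 2 (X.NearSphere X.origin s ⟨×⟩ Y.NearSphere Y.origin t)
    middle s t = cop-round (λ σ x → X.dist x (X.center X.origin s σ) ≤ 2) (λ τ y → Y.dist y (Y.center Y.origin t τ) ≤ 2)
                   (X.origin X.⊕ s) (Y.origin Y.⊕ t) X.near-center-move Y.near-center-move
                   λ σ τ → final (X.center X.origin s σ) (Y.center Y.origin t τ)
    opening : CopWins G 2 ((λ _ → ⊤) ⟨×⟩ (λ _ → ⊤))
    opening = cop-round (X.NearSphere X.origin) (Y.NearSphere Y.origin) X.origin Y.origin
                (λ _ → X.near-sphere X.origin) (λ _ → Y.near-sphere Y.origin) middle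

  neighbour : V G → Fin 4 → V G
  neighbour (x , y) zero                   = x X.⊕ 1 , y
  neighbour (x , y) (suc zero)             = x X.⊕ (2 * p ∸ 1) , y
  neighbour (x , y) (suc (suc zero))       = x , y Y.⊕ 1
  neighbour (x , y) (suc (suc (suc zero))) = x , y Y.⊕ (2 * q ∸ 1)

  adj-neighbour : ∀ v i → Adj G v (neighbour v i)
  adj-neighbour (x , y) zero                   = inj₁ (X.adj-⊕1 x , refl)
  adj-neighbour (x , y) (suc zero)             = inj₁ (X.adj-⊕pred x , refl)
  adj-neighbour (x , y) (suc (suc zero))       = inj₂ (refl , Y.adj-⊕1 y)
  adj-neighbour (x , y) (suc (suc (suc zero))) = inj₂ (refl , Y.adj-⊕pred y)

  neighbour-distinct : ∀ v {i j} → i Fin.< j → neighbour v i ≢ neighbour v j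
  neighbour-distinct (x , y) {zero}           {suc zero}             _ = X.⊕1≢⊕pred 3≤2p x ∘ cong proj₁
  neighbour-distinct (x , y) {zero}           {suc (suc zero)}       _ = X.⊕1≢self 3≤2p x ∘ cong proj₁
  neighbour-distinct (x , y) {zero}           {suc (suc (suc zero))} _ = X.⊕1≢self 3≤2p x ∘ cong proj₁
  neighbour-distinct (x , y) {suc zero}       {suc (suc zero)}       _ = X.⊕pred≢self 3≤2p x ∘ cong proj₁
  neighbour-distinct (x , y) {suc zero}       {suc (suc (suc zero))} _ = X.⊕pred≢self 3≤2p x ∘ cong proj₁
  neighbour-distinct (x , y) {suc (suc zero)} {suc (suc (suc zero))} _ = Y.⊕1≢⊕pred 3≤2q y ∘ cong proj₂
  neighbour-distinct v {_}                     {zero}                 ()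
  neighbour-distinct v {suc _}                 {suc zero}             (s≤s ())
  neighbour-distinct v {suc (suc _)}           {suc (suc zero)}       (s≤s (s≤s ()))
  neighbour-distinct v {suc (suc (suc _))}     {suc (suc (suc zero))} (s≤s (s≤s (s≤s ())))

  -- The four neighbours of v lie at distance dist v b - 1, dist v b or dist v b + 1 from b,
  -- so two of them are at the same distance.
  twins : ∀ v b → TwinNeighbours G dist v b
  twins v b = pick (window-pigeonhole (s≤s (s≤s (s≤s (s≤s z≤n)))) (λ i → dist (neighbour v i) b) {dist v b}
                      (λ i → dist-lipschitz b (adj-sym (adj-neighbour v i))) (λ i → dist-lipschitz b (adj-neighbour v i)))
    where
    pick : ∃₂ (λ i j → i Fin.< j × dist (neighbour v i) b ≡ dist (neighbour v j) b) → TwinNeighbours G dist v b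
    pick (i , j , i<j , same) =
      neighbour v i , neighbour v j , adj-neighbour v i , adj-neighbour v j , neighbour-distinct v i<j , same

  one-cop-fails : ¬ CopWinsWith G 1
  one-cop-fails wins = one-cop-loses G dist dist-isDist twins wins origin λ _ _ → tt

proposition5p17 : (p q : ℕ) → 4 ≤ p → 4 ≤ q → q ≤ p →
    LocalizationNumberIs (Cycle (2 * p) □ Cycle (2 * q)) 2
proposition5p17 p q 4≤p 4≤q _ = s≤s z≤n , cop-wins , fewer-cops-fail
  where
  open Torus p q 4≤p 4≤q
  fewer-cops-fail : ∀ j → 1 ≤ j → suc j ≤ 2 → ¬ CopWinsWith G j
  fewer-cops-fail 1 _ _ = one-cop-fails
  fewer-cops-fail (suc (suc _)) _ (s≤s (s≤s ()))
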